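{- Let $1\le k<n$ and let $u\in\mathbb R^n$ with $\sum_{i=1}^n u_i=0$. Suppose $u$ has at least $k$ coordinates equal to $a+\frac rs$ and at least $k$ coordinates equal to $-b+\frac rs$, where $a,b,r,s$ are non-negative integers with $b\ne0$, $0\le r<s$, $\gcd(r,s)=1$ and $s$ dividing $\gcd(n,k)$. If $W^Tu$ is an NZI $\theta_1(J(n,k))$-eigenvector of $J(n,k)$, then $\frac{k(bs-r)}{s(a+b)}$ is not an integer.
   Context: $J(n,k)$ is the Johnson graph on the $k$-subsets of $\{1,\dots,n\}$ (adjacent iff they meet in $k-1$ elements); $\theta_1(J(n,k))=(k-1)(n-k-1)-1$ is its second largest eigenvalue. $W$ is the incidence matrix of points of $\{1,\dots,n\}$ versus $k$-subsets, so $(W^Tu)_K=\sum_{i\in K}u_i$. NZI means all entries nonzero integers.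
   Formalization: The vector u is taken in ℚ^n rather than ℝ^n. -}

module Defs where

open import Data.Nat as ℕ using (ℕ; zero; suc)
open import Data.Integer as ℤ using (ℤ; +_)
open import Data.Rational as ℚ using (ℚ; 0ℚ)
open import Data.Rational.Properties using (_≟_)
open import Data.Fin using (Fin)
open import Data.Fin.Subset using (Subset; Side; inside; outside; ∣_∣; _∩_)
open import Data.Vec using (Vec; []; _∷_; lookup)
open import Data.List using (List; []; _∷_; _++_; map; filter; length; foldr)
open import Data.List using (allFin)
open import Data.Bool using (Bool; true; false)
open import Relation.Binary.PropositionalEquality using (_≡_)
open import Relation.Nullary using (Dec; yes; no)

sumℚ : ∀ {n} → (Fin n → ℚ) → ℚ
sumℚ {zero}  f = 0ℚ
sumℚ {suc n} f = f Fin.zero ℚ.+ sumℚ (λ i → f (Fin.suc i))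
  where import Data.Fin as Fin

allSubsets : (n : ℕ) → List (Subset n)
allSubsets zero    = [] ∷ []
allSubsets (suc n) = map (outside ∷_) (allSubsets n) ++ map (inside ∷_) (allSubsets n)

kSubsets : (n k : ℕ) → List (Subset n)
kSubsets n k = filter (λ K → ∣ K ∣ ℕ.≟ k) (allSubsets n)

WT : ∀ {n} → (Fin n → ℚ) → Subset n → ℚ
WT u K = sumℚ (λ i → pick (lookup K i) (u i))
  where
  pick : Side → ℚ → ℚ
  pick inside  x = x
  pick outside _ = 0ℚ

sumList : List ℚ → ℚ
sumList = foldr ℚ._+_ 0ℚ

adjJ : (n k : ℕ) → (Subset n → ℚ) → Subset n → ℚ
adjJ n k x K = sumList (map x (filter (λ L → ∣ K ∩ L ∣ ℕ.≟ k ℕ.∸ 1) (kSubsets n k)))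

θ₁ : ℕ → ℕ → ℤ
θ₁ n k = + ((k ℕ.∸ 1) ℕ.* (n ℕ.∸ k ℕ.∸ 1)) ℤ.- + 1

IsEigenvectorJ : (n k : ℕ) → ℚ → (Subset n → ℚ) → Set
IsEigenvectorJ n k λ' x =
  (∃ λ K → ∣ K ∣ ≡ k × ¬ (x K ≡ 0ℚ)) ×
  (∀ K → ∣ K ∣ ≡ k → adjJ n k x K ≡ λ' ℚ.* x K)
  where
  open import Data.Product using (∃; _×_)
  open import Relation.Nullary using (¬_)

IsNZI : (n k : ℕ) → (Subset n → ℚ) → Set
IsNZI n k x = ∀ K → ∣ K ∣ ≡ k → ∃ λ z → ¬ (z ≡ + 0) × x K ≡ z ℚ./ 1
  where
  open import Data.Product using (∃; _×_)
  open import Relation.Nullary using (¬_)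

countEq : ∀ {n} → (Fin n → ℚ) → ℚ → ℕ
countEq {n} u c = length (filter (λ i → u i ≟ c) (allFin n))

-- p / d as a rational (d = 0 gives 0; only used with d ≠ 0)
_/'_ : ℤ → ℕ → ℚ
p /' zero  = 0ℚ
p /' suc d = p ℚ./ suc d

IsIntegerℚ : ℚ → Set
IsIntegerℚ q = ∃ λ (z : ℤ) → q ≡ z ℚ./ 1
  where open import Data.Product using (∃)

{-# OPTIONS --safe #-}

-- If q = k(bs − r)/(s(a + b)) were an integer j, then 0 ≤ j ≤ k (as 0 ≤ bs − r ≤ s(a + b)),
-- so some k-subset K consists of j coordinates equal to α = a + r/s and k − j equal to
-- β = −b + r/s.  Then (Wᵀu)_K = jα + (k − j)β = (j s(a + b) − k(bs − r))/s = 0, contradicting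
-- NZI.  Beyond b ≠ 0 and r < s, no other hypothesis (sum zero, eigenvector, gcd conditions,
-- s ∣ gcd(n, k)) is needed.

module Submission where

open import Defs
open import Data.Nat as ℕ using (ℕ; zero; suc; _≤_; _<_; z≤n; s≤s⁻¹)
import Data.Nat.Properties as ℕ
open import Data.Nat.Divisibility using (_∣_; divides)
open import Data.Nat.GCD using (gcd)
open import Data.Integer as ℤ using (ℤ; +_; -[1+_]; 0ℤ)
import Data.Integer.Properties as ℤ
open import Data.Integer.Solver using (module +-*-Solver)
open import Data.Rational as ℚ using (ℚ; 0ℚ; _/_; _+_; -_; toℚᵘ)
open import Data.Rational.Properties
  using (_≟_; +-identityˡ; +-identityʳ; +-assoc; 0/n≡0; +-0-group; +-0-commutativeMonoid;
         toℚᵘ-fromℚᵘ; toℚᵘ-injective; toℚᵘ-cong; toℚᵘ-homo-+; fromℚᵘ-cong)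
import Data.Rational.Unnormalised as ℚᵘ
import Data.Rational.Unnormalised.Properties as ℚᵘ
open import Algebra.Bundles using (CommutativeMonoid)
open import Algebra.Definitions.RawMonoid ℚ.+-0-rawMonoid using (_×_)
open import Algebra.Properties.Group +-0-group using (∙-cancelʳ)
open import Algebra.Properties.CommutativeSemigroup
  (CommutativeMonoid.commutativeSemigroup +-0-commutativeMonoid) using (x∙yz≈y∙xz)
open import Data.Fin as Fin using (Fin; zero; suc)
open import Data.Fin.Subset using (Subset; inside; outside; ∣_∣)
open import Data.Vec using ([]; _∷_)
open import Data.List using ([]; _∷_; map; filter; length; tabulate; allFin)
open import Data.List.Properties using (filter-accept; filter-reject; map-tabulate)
open import Data.Product using (_,_)
open import Function using (_∘_)
open import Relation.Unary using (Pred; Decidable)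
open import Relation.Nullary using (¬_; Dec; yes; no; contradiction)
open import Relation.Binary.PropositionalEquality
  using (_≡_; refl; sym; trans; cong; cong₂; subst; module ≡-Reasoning)

toℚᵘ-/ : ∀ i d → toℚᵘ (i / suc d) ℚᵘ.≃ ℚᵘ.mkℚᵘ i d
toℚᵘ-/ i d = toℚᵘ-fromℚᵘ (ℚᵘ.mkℚᵘ i d)

/-cross-multiply : ∀ i j d e → i / suc d ≡ j / suc e → i ℤ.* + suc e ≡ j ℤ.* + suc d
/-cross-multiply i j d e eq
  with ℚᵘ.*≡* cross ← ℚᵘ.≃-trans (ℚᵘ.≃-sym (toℚᵘ-/ i d)) (ℚᵘ.≃-trans (toℚᵘ-cong eq) (toℚᵘ-/ j e))
  = cross

cross-multiply⇒/-≡ : ∀ i j d e → i ℤ.* + suc e ≡ j ℤ.* + suc d → i / suc d ≡ j / suc e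
cross-multiply⇒/-≡ i j d e cross = fromℚᵘ-cong {ℚᵘ.mkℚᵘ i d} {ℚᵘ.mkℚᵘ j e} (ℚᵘ.*≡* cross)

/1-injective : ∀ i j → i / 1 ≡ j / 1 → i ≡ j
/1-injective i j eq = begin
  i            ≡⟨ ℤ.*-identityʳ i ⟨
  i ℤ.* + 1    ≡⟨ /-cross-multiply i j 0 0 eq ⟩
  j ℤ.* + 1    ≡⟨ ℤ.*-identityʳ j ⟩
  j            ∎
  where open ≡-Reasoning

/-+-/ : ∀ i j d → i / suc d + j / suc d ≡ (i ℤ.+ j) / suc d
/-+-/ i j d = toℚᵘ-injective (begin-equality
  toℚᵘ (i / suc d + j / suc d)            ≃⟨ toℚᵘ-homo-+ (i / suc d) (j / suc d) ⟩
  toℚᵘ (i / suc d) ℚᵘ.+ toℚᵘ (j / suc d)  ≃⟨ ℚᵘ.+-cong (toℚᵘ-/ i d) (toℚᵘ-/ j d) ⟩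
  ℚᵘ.mkℚᵘ i d ℚᵘ.+ ℚᵘ.mkℚᵘ j d            ≃⟨ ℚᵘ.*≡* cross ⟩
  ℚᵘ.mkℚᵘ (i ℤ.+ j) d                     ≃⟨ toℚᵘ-/ (i ℤ.+ j) d ⟨
  toℚᵘ ((i ℤ.+ j) / suc d)                ∎)
  where
  open ℚᵘ.≤-Reasoning
  open +-*-Solver
  cross : (i ℤ.* + suc d ℤ.+ j ℤ.* + suc d) ℤ.* + suc d ≡ (i ℤ.+ j) ℤ.* (+ suc d ℤ.* + suc d)
  cross = solve 3 (λ i j n → (i :* n :+ j :* n) :* n := (i :+ j) :* (n :* n)) refl i j (+ suc d)

/1-+-/ : ∀ i j d → i / 1 + j / suc d ≡ (i ℤ.* + suc d ℤ.+ j) / suc d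
/1-+-/ i j d = begin
  i / 1 + j / suc d                    ≡⟨ cong (_+ j / suc d) i/1≡is/s ⟩
  (i ℤ.* + suc d) / suc d + j / suc d  ≡⟨ /-+-/ (i ℤ.* + suc d) j d ⟩
  (i ℤ.* + suc d ℤ.+ j) / suc d        ∎
  where
  open ≡-Reasoning
  i/1≡is/s : i / 1 ≡ (i ℤ.* + suc d) / suc d
  i/1≡is/s = cross-multiply⇒/-≡ i (i ℤ.* + suc d) 0 d (sym (ℤ.*-identityʳ _))

×-/ : ∀ m i d → m × (i / suc d) ≡ (+ m ℤ.* i) / suc d
×-/ zero    i d = sym (trans (cong (_/ suc d) (ℤ.*-zeroˡ i)) (0/n≡0 (suc d)))
×-/ (suc m) i d = begin
  i / suc d + m × (i / suc d)      ≡⟨ cong (λ x → i / suc d + x) (×-/ m i d) ⟩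
  i / suc d + (+ m ℤ.* i) / suc d  ≡⟨ /-+-/ i (+ m ℤ.* i) d ⟩
  (i ℤ.+ + m ℤ.* i) / suc d        ≡⟨ cong (_/ suc d) (ℤ.suc-* (+ m) i) ⟨
  (+ suc m ℤ.* i) / suc d          ∎
  where open ≡-Reasoning

weighted-sum-vanishes : ∀ (j c : ℕ) (a b r : ℤ) d →
  + j ℤ.* (a ℤ.* + suc d ℤ.+ r) ℤ.+ + c ℤ.* (b ℤ.* + suc d ℤ.+ r) ≡ 0ℤ →
  j × (a / 1 + r / suc d) + c × (b / 1 + r / suc d) ≡ 0ℚ
weighted-sum-vanishes j c a b r d numerator≡0 = begin
  j × (a / 1 + r / suc d) + c × (b / 1 + r / suc d)
    ≡⟨ cong₂ (λ x y → j × x + c × y) (/1-+-/ a r d) (/1-+-/ b r d) ⟩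
  j × (A / suc d) + c × (B / suc d)
    ≡⟨ cong₂ _+_ (×-/ j A d) (×-/ c B d) ⟩
  (+ j ℤ.* A) / suc d + (+ c ℤ.* B) / suc d
    ≡⟨ /-+-/ (+ j ℤ.* A) (+ c ℤ.* B) d ⟩
  (+ j ℤ.* A ℤ.+ + c ℤ.* B) / suc d
    ≡⟨ cong (_/ suc d) numerator≡0 ⟩
  0ℤ / suc d
    ≡⟨ 0/n≡0 (suc d) ⟩
  0ℚ ∎
  where
  open ≡-Reasoning
  A B : ℤ
  A = a ℤ.* + suc d ℤ.+ r
  B = b ℤ.* + suc d ℤ.+ r

nonneg+x≢neg+x : ∀ a b x → ¬ (+ a / 1 + x ≡ - (+ suc b / 1) + x)
nonneg+x≢neg+x a b x eq with /1-injective (+ a) -[1+ b ] (∙-cancelʳ x _ _ eq)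
... | ()

pos-*-∸ : ∀ k {m r} → r ≤ m → + (k ℕ.* (m ℕ.∸ r)) ≡ + k ℤ.* (+ m ℤ.- + r)
pos-*-∸ k {m} {r} r≤m = begin
  + (k ℕ.* (m ℕ.∸ r))     ≡⟨ ℤ.pos-* k (m ℕ.∸ r) ⟩
  + k ℤ.* + (m ℕ.∸ r)     ≡⟨ cong (+ k ℤ.*_) (ℤ.⊖-≥ r≤m) ⟨
  + k ℤ.* (m ℤ.⊖ r)       ≡⟨ cong (+ k ℤ.*_) (ℤ.m-n≡m⊖n m r) ⟨
  + k ℤ.* (+ m ℤ.- + r)   ∎
  where open ≡-Reasoning

isIntegerℚ⇒∣ : ∀ N D .{{_ : ℕ.NonZero D}} → IsIntegerℚ ((+ N) /' D) → D ∣ N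
isIntegerℚ⇒∣ N (suc d) (z , N/D≡z) =
  quotient z (trans (sym (ℤ.*-identityʳ (+ N))) (/-cross-multiply (+ N) z d 0 N/D≡z))
  where
  quotient : ∀ z → + N ≡ z ℤ.* + suc d → suc d ∣ N
  quotient (+ j)    N≡jD = divides j (ℤ.+-injective (trans N≡jD (sym (ℤ.pos-* j (suc d)))))
  quotient -[1+ _ ] ()

m*n∸o≤n*[l+m] : ∀ l m n o → m ℕ.* n ℕ.∸ o ≤ n ℕ.* (l ℕ.+ m)
m*n∸o≤n*[l+m] l m n o = begin
  m ℕ.* n ℕ.∸ o    ≤⟨ ℕ.m∸n≤m (m ℕ.* n) o ⟩
  m ℕ.* n          ≡⟨ ℕ.*-comm m n ⟩
  n ℕ.* m          ≤⟨ ℕ.*-monoʳ-≤ n (ℕ.m≤n+m m l) ⟩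
  n ℕ.* (l ℕ.+ m)  ∎
  where open ℕ.≤-Reasoning

quotient-≤ : ∀ {j k e D} .{{_ : ℕ.NonZero D}} → k ℕ.* e ≡ j ℕ.* D → e ≤ D → j ≤ k
quotient-≤ {j} {k} {e} {D} ke≡jD e≤D = ℕ.*-cancelʳ-≤ j k D (begin
  j ℕ.* D   ≡⟨ ke≡jD ⟨
  k ℕ.* e   ≤⟨ ℕ.*-monoʳ-≤ k e≤D ⟩
  k ℕ.* D   ∎)
  where open ℕ.≤-Reasoning

numerator-vanishes : ∀ a b r s j c {k} → r ≤ b ℕ.* s →
  k ℕ.* (b ℕ.* s ℕ.∸ r) ≡ j ℕ.* (s ℕ.* (a ℕ.+ b)) → j ℕ.+ c ≡ k →
  + j ℤ.* (+ a ℤ.* + s ℤ.+ + r) ℤ.+ + c ℤ.* (ℤ.- + b ℤ.* + s ℤ.+ + r) ≡ 0ℤ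
numerator-vanishes a b r s j c r≤bs balance refl = begin
  J ℤ.* (A ℤ.* S ℤ.+ R) ℤ.+ C ℤ.* (ℤ.- B ℤ.* S ℤ.+ R)
    ≡⟨ solve 6 (λ A B R S J C → J :* (A :* S :+ R) :+ C :* (:- B :* S :+ R)
                               := J :* (S :* (A :+ B)) :- (J :+ C) :* (B :* S :- R)) refl A B R S J C ⟩
  J ℤ.* (S ℤ.* (A ℤ.+ B)) ℤ.- (J ℤ.+ C) ℤ.* (B ℤ.* S ℤ.- R)
    ≡⟨ cong₂ ℤ._-_ lhs rhs ⟨
  + (j ℕ.* (s ℕ.* (a ℕ.+ b))) ℤ.- + ((j ℕ.+ c) ℕ.* (b ℕ.* s ℕ.∸ r))
    ≡⟨ cong (λ y → + (j ℕ.* (s ℕ.* (a ℕ.+ b))) ℤ.- + y) balance ⟩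
  + (j ℕ.* (s ℕ.* (a ℕ.+ b))) ℤ.- + (j ℕ.* (s ℕ.* (a ℕ.+ b)))
    ≡⟨ ℤ.+-inverseʳ (+ (j ℕ.* (s ℕ.* (a ℕ.+ b)))) ⟩
  0ℤ ∎
  where
  open ≡-Reasoning
  open +-*-Solver
  A B R S J C : ℤ
  A = + a; B = + b; R = + r; S = + s; J = + j; C = + c
  lhs : + (j ℕ.* (s ℕ.* (a ℕ.+ b))) ≡ J ℤ.* (S ℤ.* (A ℤ.+ B))
  lhs = trans (ℤ.pos-* j _) (cong (J ℤ.*_) (trans (ℤ.pos-* s _) (cong (S ℤ.*_) (ℤ.pos-+ a b))))
  rhs : + ((j ℕ.+ c) ℕ.* (b ℕ.* s ℕ.∸ r)) ≡ (J ℤ.+ C) ℤ.* (B ℤ.* S ℤ.- R)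
  rhs = trans (pos-*-∸ (j ℕ.+ c) r≤bs) (cong₂ (λ x y → x ℤ.* (y ℤ.- R)) (ℤ.pos-+ j c) (ℤ.pos-* b s))

module _ {a b p} {A : Set a} {B : Set b} {P : Pred B p} (P? : Decidable P) where

  length-filter-map : ∀ (f : A → B) xs → length (filter P? (map f xs)) ≡ length (filter (P? ∘ f) xs)
  length-filter-map f []       = refl
  length-filter-map f (x ∷ xs) with P? (f x)
  ... | yes _ = cong suc (length-filter-map f xs)
  ... | no  _ = length-filter-map f xs

module _ {n} (u : Fin (suc n) → ℚ) {c : ℚ} where

  private
    count-tail : length (filter (λ i → u i ≟ c) (tabulate suc)) ≡ countEq (u ∘ suc) c
    count-tail = trans (cong (length ∘ filter (λ i → u i ≟ c)) (sym (map-tabulate (λ i → i) (Fin.suc {n}))))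
                       (length-filter-map (λ i → u i ≟ c) suc (allFin n))

  countEq-here : u zero ≡ c → countEq u c ≡ suc (countEq (u ∘ suc) c)
  countEq-here u₀≡c = trans (cong length (filter-accept (λ i → u i ≟ c) u₀≡c)) (cong suc count-tail)

  countEq-there : ¬ u zero ≡ c → countEq u c ≡ countEq (u ∘ suc) c
  countEq-there u₀≢c = trans (cong length (filter-reject (λ i → u i ≟ c) u₀≢c)) count-tail

module _ {α β : ℚ} where

  record SubsetWithSum {n} (u : Fin n → ℚ) (p q : ℕ) : Set where
    constructor ⟨_,_,_⟩
    field
      subset : Subset n
      size   : ∣ subset ∣ ≡ p ℕ.+ q
      sum    : WT u subset ≡ p × α + q × β

  private
    skip-head : ∀ {n} {u : Fin (suc n) → ℚ} {p q} → SubsetWithSum (u ∘ suc) p q → SubsetWithSum u p q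
    skip-head ⟨ K , ∣K∣≡ , WT≡ ⟩ = ⟨ outside ∷ K , ∣K∣≡ , trans (+-identityˡ _) WT≡ ⟩

    take-α : ∀ {n} {u : Fin (suc n) → ℚ} {p q} → u zero ≡ α →
             SubsetWithSum (u ∘ suc) p q → SubsetWithSum u (suc p) q
    take-α {p = p} {q} u₀≡α ⟨ K , ∣K∣≡ , WT≡ ⟩ =
      ⟨ inside ∷ K , cong suc ∣K∣≡ , trans (cong₂ _+_ u₀≡α WT≡) (sym (+-assoc α (p × α) (q × β))) ⟩

    take-β : ∀ {n} {u : Fin (suc n) → ℚ} {p q} → u zero ≡ β →
             SubsetWithSum (u ∘ suc) p q → SubsetWithSum u p (suc q)
    take-β {p = p} {q} u₀≡β ⟨ K , ∣K∣≡ , WT≡ ⟩ =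
      ⟨ inside ∷ K , trans (cong suc ∣K∣≡) (sym (ℕ.+-suc p q)) ,
        trans (cong₂ _+_ u₀≡β WT≡) (x∙yz≈y∙xz β (p × α) (q × β)) ⟩

  subsetWithSum : ¬ α ≡ β → ∀ {n} (u : Fin n → ℚ) p q →
                  p ≤ countEq u α → q ≤ countEq u β → SubsetWithSum u p q
  subsetWithSum _ {zero} u zero zero _ _ = ⟨ [] , refl , sym (+-identityʳ 0ℚ) ⟩
  subsetWithSum α≢β {suc n} u = byHead (u zero ≟ α) (u zero ≟ β)
    where
    recurse : ∀ p q → p ≤ countEq (u ∘ suc) α → q ≤ countEq (u ∘ suc) β → SubsetWithSum (u ∘ suc) p q
    recurse = subsetWithSum α≢β (u ∘ suc)

    here : ∀ {c p} → u zero ≡ c → suc p ≤ countEq u c → p ≤ countEq (u ∘ suc) c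
    here u₀≡c p<#c = s≤s⁻¹ (subst (_ ≤_) (countEq-here u u₀≡c) p<#c)

    there : ∀ {c p} → ¬ u zero ≡ c → p ≤ countEq u c → p ≤ countEq (u ∘ suc) c
    there u₀≢c = subst (_ ≤_) (countEq-there u u₀≢c)

    byHead : Dec (u zero ≡ α) → Dec (u zero ≡ β) →
             ∀ p q → p ≤ countEq u α → q ≤ countEq u β → SubsetWithSum u p q
    byHead (yes u₀≡α) (yes u₀≡β) _ _ _ _ = contradiction (trans (sym u₀≡α) u₀≡β) α≢β
    byHead (yes u₀≡α) (no u₀≢β) zero q _ q≤ = skip-head (recurse 0 q z≤n (there u₀≢β q≤))
    byHead (yes u₀≡α) (no u₀≢β) (suc p) q p< q≤ = take-α u₀≡α (recurse p q (here u₀≡α p<) (there u₀≢β q≤))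
    byHead (no u₀≢α) (yes u₀≡β) p zero p≤ _ = skip-head (recurse p 0 (there u₀≢α p≤) z≤n)
    byHead (no u₀≢α) (yes u₀≡β) p (suc q) p≤ q< = take-β u₀≡β (recurse p q (there u₀≢α p≤) (here u₀≡β q<))
    byHead (no u₀≢α) (no u₀≢β) p q p≤ q≤ = skip-head (recurse p q (there u₀≢α p≤) (there u₀≢β q≤))

NZI⇒≢0 : ∀ {n k} {x : Subset n → ℚ} → IsNZI n k x → ∀ {K} → ∣ K ∣ ≡ k → ¬ x K ≡ 0ℚ
NZI⇒≢0 nzi ∣K∣≡k xK≡0 with nzi _ ∣K∣≡k
... | z , z≢0 , xK≡z = z≢0 (/1-injective z 0ℤ (trans (sym xK≡z) xK≡0))

lemma2 : (n k : ℕ) → 1 ≤ k → k < n →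
    (u : Fin n → ℚ) → sumℚ u ≡ 0ℚ →
    (a b r s : ℕ) → ¬ (b ≡ 0) → r < s → gcd r s ≡ 1 → s ∣ gcd n k →
    k ≤ countEq u ((+ a ℚ./ 1) ℚ.+ ((+ r) /' s)) →
    k ≤ countEq u ((ℚ.- (+ b ℚ./ 1)) ℚ.+ ((+ r) /' s)) →
    IsNZI n k (WT u) →
    IsEigenvectorJ n k (θ₁ n k ℚ./ 1) (WT u) →
    ¬ IsIntegerℚ ((+ k ℤ.* (+ (b ℕ.* s) ℤ.- + r)) /' (s ℕ.* (a ℕ.+ b)))
lemma2 _ _ _ _ _ _ _ zero    _ _    b≢0 _ _ _ _ _ _ _ = contradiction refl b≢0
lemma2 _ _ _ _ _ _ _ (suc _) _ zero _   () _ _ _ _ _ _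
lemma2 n k _ _ u _ a b@(suc b′) r s@(suc s′) _ r<s _ _ k≤#α k≤#β nzi _ integral =
  NZI⇒≢0 nzi {K} (trans size j+c≡k) (trans sum
    -- ℚ.- (+ b / 1) is definitionally -[1+ b′ ] / 1
    (weighted-sum-vanishes j c (+ a) -[1+ b′ ] (+ r) s′
      (numerator-vanishes a b r s j c r≤bs N≡jD j+c≡k)))
  where
  D : ℕ
  D = s ℕ.* (a ℕ.+ b)
  instance
    D≢0 : ℕ.NonZero D
    D≢0 = ℕ.m*n≢0 s (a ℕ.+ b) {{_}} {{ℕ.≢-nonZero (ℕ.m+1+n≢0 a)}}
  r≤bs : r ≤ b ℕ.* s
  r≤bs = ℕ.≤-trans (ℕ.<⇒≤ r<s) (ℕ.m≤n*m s b)
  D∣N : D ∣ k ℕ.* (b ℕ.* s ℕ.∸ r)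
  D∣N = isIntegerℚ⇒∣ _ D (subst (λ i → IsIntegerℚ (i /' D)) (sym (pos-*-∸ k r≤bs)) integral)
  open _∣_ D∣N renaming (quotient to j; equality to N≡jD)
  j≤k : j ≤ k
  j≤k = quotient-≤ N≡jD (m*n∸o≤n*[l+m] a b s r)
  c : ℕ
  c = k ℕ.∸ j
  j+c≡k : j ℕ.+ c ≡ k
  j+c≡k = ℕ.m+[n∸m]≡n j≤k
  open SubsetWithSum (subsetWithSum (nonneg+x≢neg+x a b′ _) u j c
                       (ℕ.≤-trans j≤k k≤#α) (ℕ.≤-trans (ℕ.m∸n≤m k j) k≤#β))
    renaming (subset to K)
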